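{- Let $G=([n],E)$ be a terrain-like graph and let $\{a,b\}\in E$ with $a<b$ be a $\preceq$-minimal edge (i.e. there is no $e\in E$, $e\neq\{a,b\}$, with $e\preceq\{a,b\}$). Then $G'=([n],E\setminus\{\{a,b\}\})$ is terrain-like and $\Pi(G)=(2a,2b-1)\,\Pi(G')$.
   Context: $[n]=\{1,\dots,n\}$; $\mathcal{S}_{2n}$ is the symmetric group on $[2n]$, with product meaning composition, $(\sigma\rho)(x)=\sigma(\rho(x))$; $(a,b)$ denotes a transposition. A graph $G=([n],E)$ is terrain-like if for all $a<b<c<d$, $\{a,c\},\{b,d\}\in E$ implies $\{a,d\}\in E$. On $\binom{[n]}{2}$ define $\preceq$ by: for $a<b$, $c<d$, $\{a,b\}\preceq\{c,d\}$ iff $c\le a<b\le d$. A valid ordering of $E\subseteq\binom{[n]}{2}$ is a total order $\le$ on $E$ with $e\preceq e'\Rightarrow e\le e'$. For $a<b$ let $\tau(\{a,b\})=(2a,2b-1)$ and $\pi_0=(1,2)(3,4)\cdots(2n-1,2n)$. For $G=([n],E)$ with $E=\{e_1>\dots>e_m\}$ in a valid ordering, $\Pi(G)=\tau(e_m)\cdots\tau(e_1)\pi_0$, which is independent of the valid ordering chosen. -}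

module Defs where

open import Data.Nat using (ℕ; zero; suc; _+_; _*_; _∸_; _≤_; _<_; _≤?_; _≟_)
open import Data.Nat.Properties using ()
open import Data.Bool using (Bool; true; false; if_then_else_)
open import Data.Product using (_×_; _,_; proj₁; proj₂)
open import Data.Product.Properties using (≡-dec)
open import Data.List using (List; []; _∷_; foldl; filter)
open import Data.List.Membership.Propositional using (_∈_)
open import Data.List.Relation.Unary.All using (All)
open import Data.List.Relation.Unary.AllPairs using (AllPairs)
open import Data.List.Relation.Unary.Unique.Propositional using (Unique)
open import Data.List.Relation.Binary.Permutation.Propositional using (_↭_)
open import Relation.Nullary using (¬_; ¬?; does)
open import Relation.Binary.PropositionalEquality using (_≡_)

-- An (unordered) pair {a,b} with a < b is represented as the ordered pair (a , b).
Pair : Set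
Pair = ℕ × ℕ

_≟ₚ_ : (e e' : Pair) → Relation.Nullary.Dec (e ≡ e')
_≟ₚ_ = ≡-dec _≟_ _≟_

IsPair : ℕ → Pair → Set
IsPair n (a , b) = 1 ≤ a × a < b × b ≤ n

EdgeSet : ℕ → List Pair → Set
EdgeSet n E = All (IsPair n) E × Unique E

TerrainLike : List Pair → Set
TerrainLike E = ∀ a b c d → a < b → b < c → c < d →
  (a , c) ∈ E → (b , d) ∈ E → (a , d) ∈ E

_⪯_ : Pair → Pair → Set
(a , b) ⪯ (c , d) = c ≤ a × b ≤ d

-- A valid ordering of E, written as the list [e₁ , … , eₘ] with e₁ > … > eₘ:
-- it enumerates E (a permutation of E), and whenever eᵢ comes before eⱼ
-- (so eᵢ > eⱼ) we must not have eᵢ ⪯ eⱼ.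
ValidOrdering : List Pair → List Pair → Set
ValidOrdering E L = (L ↭ E) × AllPairs (λ e e' → ¬ (e ⪯ e')) L

-- Permutations of [2n] represented as functions ℕ → ℕ (identity off [2n]);
-- product is composition.
Perm : Set
Perm = ℕ → ℕ

_∘ₚ_ : Perm → Perm → Perm
(σ ∘ₚ ρ) x = σ (ρ x)

swap : ℕ → ℕ → Perm
swap i j x = if does (x ≟ i) then j else (if does (x ≟ j) then i else x)

τ : Pair → Perm
τ (a , b) = swap (2 * a) (2 * b ∸ 1)

even : ℕ → Bool
even zero = true
even (suc k) with even k
... | true = false
... | false = true

-- π₀ = (1,2)(3,4)⋯(2n-1,2n)
π₀ : ℕ → Perm
π₀ n zero = zero
π₀ n (suc k) = if does (suc k ≤? 2 * n)
                 then (if even (suc k) then k else suc (suc k))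
                 else suc k

-- Π computed from a valid ordering [e₁ , … , eₘ]: τ(eₘ) ⋯ τ(e₁) π₀
ΠL : ℕ → List Pair → Perm
ΠL n L = foldl (λ acc e → τ e ∘ₚ acc) (π₀ n) L

remove : Pair → List Pair → List Pair
remove e E = filter (λ e' → ¬? (e' ≟ₚ e)) E

_≈[_]_ : Perm → ℕ → Perm → Set
σ ≈[ n ] ρ = ∀ x → 1 ≤ x → x ≤ 2 * n → σ x ≡ ρ x

-- Incomparable pairs {a,b}, {c,d} have a ≠ c and b ≠ d, and 2a is even while 2b − 1 is odd,
-- so τ{a,b} and τ{c,d} are disjoint transpositions and commute. Two valid orderings of the
-- same edge set therefore give the same product: the first edge of one ordering is
-- incomparable with every edge preceding it in the other, so it can be moved to the front.
-- A ⪯-minimal edge {a,b} is below no other edge, so appending it to a valid ordering of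
-- E ∖ {{a,b}} gives a valid ordering of E, whose product is τ{a,b} Π(G').
-- Terrain-likeness survives the removal: an edge {a,d} forced by {a,c}, {b,d} with c < d
-- lies above {a,c}, so it cannot be the minimal edge.

module Submission where

open import Defs
open import Data.Nat using (ℕ; suc; _+_; _<_; _*_; _∸_; _≟_)
open import Data.Nat.Properties using (≤-refl; <⇒≤; ≤-total; +-suc; *-cancelˡ-≡; suc-injective; even≢odd)
open import Data.Product using (_×_; _,_)
open import Data.Sum using (inj₁; inj₂)
open import Data.List using (List; []; _∷_; _++_; _∷ʳ_; foldl)
open import Data.List.Properties using (filter-all; filter-reject; foldl-∷ʳ)
open import Data.List.Membership.Propositional using (_∈_)
open import Data.List.Membership.Propositional.Properties using (∈-∃++; ∈-++⁺ˡ; ∈-filter⁻; ∈-filter⁺)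
open import Data.List.Relation.Unary.All as All using (All; []; _∷_)
import Data.List.Relation.Unary.All.Properties as All
open import Data.List.Relation.Unary.Any using (here; there)
open import Data.List.Relation.Unary.AllPairs using (AllPairs; []; _∷_)
import Data.List.Relation.Unary.AllPairs.Properties as AllPairs
open import Data.List.Relation.Unary.Unique.Propositional using (Unique)
open import Data.List.Relation.Binary.Permutation.Propositional
  using (_↭_; ↭-sym; ↭-trans; prep; module PermutationReasoning)
open import Data.List.Relation.Binary.Permutation.Propositional.Properties
  using (↭-empty-inv; ∈-resp-↭; All-resp-↭; shift; drop-∷; ∷↭∷ʳ; filter-↭)
open import Function using (_∘_)
open import Relation.Nullary using (¬_; yes; no; ¬?; contradiction)
open import Relation.Unary using (Decidable)
open import Relation.Nullary.Decidable using (dec-true; dec-false)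
open import Relation.Binary.PropositionalEquality
  using (_≡_; _≢_; refl; sym; trans; cong; cong-app; _≗_; module ≡-Reasoning)

swap-≢ : ∀ {i j x} → x ≢ i → x ≢ j → swap i j x ≡ x
swap-≢ {i} {j} {x} x≢i x≢j rewrite dec-false (x ≟ i) x≢i | dec-false (x ≟ j) x≢j = refl

swap-fst : ∀ i j → swap i j i ≡ j
swap-fst i j rewrite dec-true (i ≟ i) refl = refl

swap-snd : ∀ i j → swap i j j ≡ i
swap-snd i j with j ≟ i
... | yes refl = swap-fst j j
... | no j≢i rewrite dec-false (j ≟ i) j≢i | dec-true (j ≟ j) refl = refl

swap-comm : ∀ {i j k l} → i ≢ k → i ≢ l → j ≢ k → j ≢ l →
  swap i j ∘ swap k l ≗ swap k l ∘ swap i j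
swap-comm {i} {j} {k} {l} i≢k i≢l j≢k j≢l x with x ≟ i | x ≟ j | x ≟ k | x ≟ l
... | yes refl | _ | _ | _
  rewrite swap-≢ i≢k i≢l | swap-fst x j | swap-≢ j≢k j≢l = refl
... | no x≢i | yes refl | _ | _
  rewrite swap-≢ j≢k j≢l | swap-snd i x | swap-≢ i≢k i≢l = refl
... | no x≢i | no x≢j | yes refl | _
  rewrite swap-fst x l | swap-≢ x≢i x≢j | swap-≢ (i≢l ∘ sym) (j≢l ∘ sym) | swap-fst x l = refl
... | no x≢i | no x≢j | no x≢k | yes refl
  rewrite swap-snd k x | swap-≢ x≢i x≢j | swap-≢ (i≢k ∘ sym) (j≢k ∘ sym) | swap-snd k x = refl
... | no x≢i | no x≢j | no x≢k | no x≢l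
  rewrite swap-≢ x≢k x≢l | swap-≢ x≢i x≢j | swap-≢ x≢k x≢l = refl

2[1+n]∸1≡1+2n : ∀ n → 2 * suc n ∸ 1 ≡ suc (2 * n)
2[1+n]∸1≡1+2n n = +-suc n (n + 0)

Ordered : Pair → Set
Ordered (a , b) = a < b

Ordered-IsPair : ∀ {n p} → IsPair n p → Ordered p
Ordered-IsPair (_ , a<b , _) = a<b

_⋠_ : Pair → Pair → Set
p ⋠ q = ¬ p ⪯ q

⪯-refl : ∀ {p} → p ⪯ p
⪯-refl = ≤-refl , ≤-refl

incomparable⇒fst≢ : ∀ {a b c d} → (a , b) ⋠ (c , d) → (c , d) ⋠ (a , b) → a ≢ c
incomparable⇒fst≢ {b = b} {d = d} p⋠q q⋠p refl with ≤-total b d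
... | inj₁ b≤d = p⋠q (≤-refl , b≤d)
... | inj₂ d≤b = q⋠p (≤-refl , d≤b)

incomparable⇒snd≢ : ∀ {a b c d} → (a , b) ⋠ (c , d) → (c , d) ⋠ (a , b) → b ≢ d
incomparable⇒snd≢ {a} {c = c} p⋠q q⋠p refl with ≤-total a c
... | inj₁ a≤c = q⋠p (a≤c , ≤-refl)
... | inj₂ c≤a = p⋠q (c≤a , ≤-refl)

τ-comm : ∀ {p q} → Ordered p → Ordered q → p ⋠ q → q ⋠ p → τ p ∘ τ q ≗ τ q ∘ τ p
τ-comm {a , suc b} {c , suc d} _ _ p⋠q q⋠p = swap-comm 2a≢2c 2a≢2d-1 2b-1≢2c 2b-1≢2d-1
  where
  2a≢2c : 2 * a ≢ 2 * c
  2a≢2c = incomparable⇒fst≢ p⋠q q⋠p ∘ *-cancelˡ-≡ a c 2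
  2a≢2d-1 : 2 * a ≢ 2 * suc d ∸ 1
  2a≢2d-1 eq = even≢odd a d (trans eq (2[1+n]∸1≡1+2n d))
  2b-1≢2c : 2 * suc b ∸ 1 ≢ 2 * c
  2b-1≢2c eq = even≢odd c b (trans (sym eq) (2[1+n]∸1≡1+2n b))
  2b-1≢2d-1 : 2 * suc b ∸ 1 ≢ 2 * suc d ∸ 1
  2b-1≢2d-1 eq = incomparable⇒snd≢ p⋠q q⋠p (cong suc (*-cancelˡ-≡ b d 2 (suc-injective
    (trans (sym (2[1+n]∸1≡1+2n b)) (trans eq (2[1+n]∸1≡1+2n d))))))

AllPairs-pivot : ∀ {A : Set} {R : A → A → Set} xs {y ys} → AllPairs R (xs ++ y ∷ ys) →
  All (λ x → R x y) xs × All (R y) ys × AllPairs R (xs ++ ys)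
AllPairs-pivot []       (Ry ∷ Rys) = [] , Ry , Rys
AllPairs-pivot (x ∷ xs) (Rx ∷ Rxs) with All.++⁻ xs Rx | AllPairs-pivot xs Rxs
... | Rx-xs , Rxy ∷ Rx-ys | before , after , rest = Rxy ∷ before , after , All.++⁺ Rx-xs Rx-ys ∷ rest

module _ {A X : Set} (act : A → X → X) where

  actSeq : List A → X → X
  actSeq []      x = x
  actSeq (e ∷ L) x = actSeq L (act e x)

  foldl-act : ∀ (f : X → X) L x → foldl (λ g e → act e ∘ g) f L x ≡ actSeq L (f x)
  foldl-act f []      x = refl
  foldl-act f (e ∷ L) x = foldl-act (act e ∘ f) L x

  actSeq-pull : ∀ y M₁ M₂ → All (λ m → act m ∘ act y ≗ act y ∘ act m) M₁ →
    actSeq (M₁ ++ y ∷ M₂) ≗ actSeq (M₁ ++ M₂) ∘ act y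
  actSeq-pull y []       M₂ []         x = refl
  actSeq-pull y (m ∷ M₁) M₂ (comm ∷ cs) x =
    trans (actSeq-pull y M₁ M₂ cs (act m x)) (cong (actSeq (M₁ ++ M₂)) (sym (comm x)))

  module _ {P : A → Set} {R : A → A → Set} (R-irrefl : ∀ {x} → ¬ R x x)
    (commute : ∀ {x y} → P x → P y → R x y → R y x → act x ∘ act y ≗ act y ∘ act x) where

    actSeq-↭ : ∀ {L M} → All P L → AllPairs R L → AllPairs R M → L ↭ M → actSeq L ≗ actSeq M
    actSeq-↭ {[]} _ _ _ L↭M x rewrite ↭-empty-inv (↭-sym L↭M) = refl
    actSeq-↭ {y ∷ L} (Py ∷ PL) (Ry ∷ RL) RM L↭M x with ∈-∃++ (∈-resp-↭ L↭M (here refl))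
    ... | M₁ , M₂ , refl with AllPairs-pivot M₁ RM
    ... | M₁Ry , _ , RM₁M₂ =
      trans (actSeq-↭ PL RL RM₁M₂ (drop-∷ (↭-trans L↭M (shift y M₁ M₂))) (act y x))
            (sym (actSeq-pull y M₁ M₂ (All.tabulate commutes) x))
      where
      commutes : ∀ {m} → m ∈ M₁ → act m ∘ act y ≗ act y ∘ act m
      commutes m∈M₁ with ∈-resp-↭ (↭-sym L↭M) (∈-++⁺ˡ m∈M₁)
      ... | here refl   = contradiction (All.lookup M₁Ry m∈M₁) R-irrefl
      ... | there m∈L = commute (All.lookup PL m∈L) Py (All.lookup M₁Ry m∈M₁) (All.lookup Ry m∈L)

ΠL-↭ : ∀ n {L M} → All Ordered L → AllPairs _⋠_ L → AllPairs _⋠_ M → L ↭ M → ΠL n L ≗ ΠL n M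
ΠL-↭ n {L} {M} OL L-valid M-valid L↭M x = begin
  ΠL n L x               ≡⟨ foldl-act τ (π₀ n) L x ⟩
  actSeq τ L (π₀ n x)    ≡⟨ actSeq-↭ τ (λ p⋠p → p⋠p ⪯-refl) τ-comm OL L-valid M-valid L↭M (π₀ n x) ⟩
  actSeq τ M (π₀ n x)    ≡⟨ foldl-act τ (π₀ n) M x ⟨
  ΠL n M x               ∎
  where open ≡-Reasoning

≢? : (e : Pair) → Decidable (_≢ e)
≢? e = λ e' → ¬? (e' ≟ₚ e)

Minimal : Pair → List Pair → Set
Minimal e E = ∀ e' → e' ∈ E → e' ⪯ e → e' ≡ e

remove-minimal-terrainLike : ∀ {E e} → TerrainLike E → Minimal e E → TerrainLike (remove e E)
remove-minimal-terrainLike {e = e} terrain minimal a b c d a<b b<c c<d ac∈ bd∈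
  with ∈-filter⁻ (≢? e) ac∈ | ∈-filter⁻ (≢? e) bd∈
... | ac∈E , ac≢e | bd∈E , _ =
  ∈-filter⁺ (≢? e) (terrain a b c d a<b b<c c<d ac∈E bd∈E) ad≢e
  where
  ad≢e : (a , d) ≢ e
  ad≢e refl = ac≢e (minimal (a , c) ac∈E (≤-refl , <⇒≤ c<d))

↭-remove : ∀ {E e} → Unique E → e ∈ E → E ↭ e ∷ remove e E
↭-remove {e = e} unique e∈E with ∈-∃++ e∈E
... | E₁ , E₂ , refl with AllPairs-pivot E₁ unique
... | E₁≢e , e≢E₂ , _ = begin
  E₁ ++ e ∷ E₂                ↭⟨ shift e E₁ E₂ ⟩
  e ∷ E₁ ++ E₂                ≡⟨ cong (e ∷_) removed ⟨
  e ∷ remove e (e ∷ E₁ ++ E₂) ↭⟨ prep e (filter-↭ _ (↭-sym (shift e E₁ E₂))) ⟩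
  e ∷ remove e (E₁ ++ e ∷ E₂) ∎
  where
  open PermutationReasoning
  removed : remove e (e ∷ E₁ ++ E₂) ≡ E₁ ++ E₂
  removed = trans (filter-reject (≢? e) (λ e≢e → e≢e refl))
                  (filter-all (≢? e) (All.++⁺ E₁≢e (All.map (_∘ sym) e≢E₂)))

validOrdering-∷ʳ-minimal : ∀ {E e L} → Minimal e E → ValidOrdering (remove e E) L →
  L ∷ʳ e ↭ e ∷ remove e E × AllPairs _⋠_ (L ∷ʳ e)
validOrdering-∷ʳ-minimal {e = e} {L} minimal (L↭E∖e , L-valid) =
  ↭-trans (↭-sym (∷↭∷ʳ e L)) (prep e L↭E∖e) ,
  AllPairs.++⁺ L-valid ([] ∷ []) (All.tabulate (λ l∈L → l⋠e l∈L ∷ []))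
  where
  l⋠e : ∀ {l} → l ∈ L → l ⋠ e
  l⋠e l∈L l⪯e with ∈-filter⁻ (≢? e) (∈-resp-↭ L↭E∖e l∈L)
  ... | l∈E , l≢e = l≢e (minimal _ l∈E l⪯e)

mainTheorem7 : (n : ℕ) (E : List Pair) → EdgeSet n E → TerrainLike E →
    (a b : ℕ) → (a , b) ∈ E →
    (∀ e → e ∈ E → e ⪯ (a , b) → e ≡ (a , b)) →
    TerrainLike (remove (a , b) E) ×
    (∀ L L' → ValidOrdering E L → ValidOrdering (remove (a , b) E) L' →
      ΠL n L ≈[ n ] (τ (a , b) ∘ₚ ΠL n L'))
mainTheorem7 n E (pairs , unique) terrain a b e∈E minimal =
  remove-minimal-terrainLike terrain minimal , Π-peel
  where
  Π-peel : ∀ L L' → ValidOrdering E L → ValidOrdering (remove (a , b) E) L' →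
    ΠL n L ≈[ n ] (τ (a , b) ∘ₚ ΠL n L')
  Π-peel L L' (L↭E , L-valid) L'-valid x _ _ with validOrdering-∷ʳ-minimal minimal L'-valid
  ... | L'e↭E , L'e-valid = begin
    ΠL n L x                  ≡⟨ ΠL-↭ n L-ordered L-valid L'e-valid L↭L'e x ⟩
    ΠL n (L' ∷ʳ (a , b)) x    ≡⟨ cong-app (foldl-∷ʳ (λ g e → τ e ∘ₚ g) (π₀ n) (a , b) L') x ⟩
    τ (a , b) (ΠL n L' x)     ∎
    where
    open ≡-Reasoning
    L-ordered : All Ordered L
    L-ordered = All.map Ordered-IsPair (All-resp-↭ (↭-sym L↭E) pairs)
    L↭L'e : L ↭ L' ∷ʳ (a , b)
    L↭L'e = ↭-trans L↭E (↭-trans (↭-remove unique e∈E) (↭-sym L'e↭E))
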